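{- Let $m\geq 2$. Then $D(P_{2m+1,2})=m+1$.
   Context: For positive integers $n,k$ with $2\le 2k<n$, the generalised Petersen graph $P_{n,k}$ has vertex set $\{u_i,v_i: i\in\{0,\dots,n-1\}\}$ and edge set $\{u_iu_{i+1}, v_iv_{i+k}, u_iv_i : i\in\{0,\dots,n-1\}\}$, indices modulo $n$. A signed graph $(G,E_-)$ is a simple graph $G$ with a set $E_-\subseteq E(G)$ of negative edges; other edges are positive. A cycle is positive if the product of its edge signs is positive; a signed graph is balanced if every cycle is positive. The frustration index $l(G,E_-)$ is the minimum number of edges whose deletion leaves a balanced signed graph, and the maximum frustration is $D(G)=\max_{E_-\subseteq E(G)} l(G,E_-)$. -}

module Defs where

open import Data.Nat using (ℕ; zero; suc; _+_; _*_; _≤_; _<_; NonZero)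
open import Data.Nat.DivMod using (_%_; m%n<n)
open import Data.Fin using (Fin; toℕ; fromℕ<; remQuot) renaming (zero to fz; suc to fs)
open import Data.Fin.Subset using (Subset; _∈_; _∉_; ∣_∣)
open import Data.Fin.Subset using (⊤)
open import Data.Product using (Σ; ∃; _×_; _,_)
open import Data.Sum using (_⊎_)
open import Data.List using (List; map)
open import Data.Nat.ListAction using (sum)
open import Data.List using (allFin)
open import Data.Bool using (Bool; true; false; if_then_else_)
open import Relation.Nullary using (Dec; yes; no; ¬_)
open import Relation.Nullary.Decidable using (⌊_⌋)
open import Data.Fin.Subset.Properties using (_∈?_)
open import Function.Definitions using (Injective)
open import Relation.Binary.PropositionalEquality using (_≡_)

-- Finite graphs given by an enumeration of their edges.
-- Vertices form a type V; edges are indexed by Fin E, edge e joining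
-- the two vertices in  ends e  (unordered: orientation is irrelevant).

record Graph : Set₁ where
  field
    V    : Set
    E    : ℕ
    ends : Fin E → V × V

open Graph public

Joins : (G : Graph) → Fin (E G) → V G → V G → Set
Joins G e x y = ends G e ≡ (x , y) ⊎ ends G e ≡ (y , x)

next : ∀ {L} → Fin (suc L) → Fin (suc L)
next {L} i = fromℕ< (m%n<n (suc (toℕ i)) (suc L))

-- A cycle of length  suc L  (L ≥ 2, i.e. length ≥ 3): pairwise distinct
-- vertices x_0 … x_L and edges e_i joining x_i and x_{i+1 mod (L+1)}.
record Cycle (G : Graph) : Set where
  field
    L        : ℕ
    long     : 2 ≤ L
    vert     : Fin (suc L) → V G
    distinct : Injective _≡_ _≡_ vert
    edge     : Fin (suc L) → Fin (E G)
    joins    : ∀ i → Joins G (edge i) (vert i) (vert (next i))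

open Cycle public

-- number of negative edges on a cycle (with multiplicity; edges of a
-- cycle in a simple graph are distinct anyway)
negCount : (G : Graph) → Subset (E G) → Cycle G → ℕ
negCount G Eneg C =
  sum (map (λ i → if ⌊ edge C i ∈? Eneg ⌋ then 1 else 0) (allFin (suc (L C))))

-- positive cycle: product of edge signs positive, i.e. an even number
-- of negative edges
Positive : (G : Graph) → Subset (E G) → Cycle G → Set
Positive G Eneg C = negCount G Eneg C % 2 ≡ 0

-- The signed graph (G − S, E₋ ∖ S) (delete the edges of S) is balanced:
-- every cycle of G avoiding S (i.e. every cycle of G − S) is positive.
BalancedAfterDeleting : (G : Graph) → Subset (E G) → Subset (E G) → Set
BalancedAfterDeleting G Eneg S =
  (C : Cycle G) → (∀ i → edge C i ∉ S) → Positive G Eneg C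

IsFrustrationIndex : (G : Graph) → Subset (E G) → ℕ → Set
IsFrustrationIndex G Eneg l =
  (Σ (Subset (E G)) λ S → ∣ S ∣ ≡ l × BalancedAfterDeleting G Eneg S)
  × ((S : Subset (E G)) → BalancedAfterDeleting G Eneg S → l ≤ ∣ S ∣)

IsMaxFrustration : Graph → ℕ → Set
IsMaxFrustration G d =
  (Σ (Subset (E G)) λ Eneg → IsFrustrationIndex G Eneg d)
  × ((Eneg : Subset (E G)) (l : ℕ) → IsFrustrationIndex G Eneg l → l ≤ d)

-- Vertices: (0 , i) = u_i, (1 , i) = v_i, i ∈ Fin n.
-- Edges indexed by Fin (3 * n) ≅ Fin 3 × Fin n:
--   (0 , i) : u_i u_{i+1},  (1 , i) : v_i v_{i+k},  (2 , i) : u_i v_i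
-- (indices modulo n).

addMod : ∀ {n} .{{_ : NonZero n}} → Fin n → ℕ → Fin n
addMod {n} i j = fromℕ< (m%n<n (toℕ i + j) n)

petersenEnds : (n k : ℕ) .{{_ : NonZero n}} → Fin 3 × Fin n
  → (Fin 2 × Fin n) × (Fin 2 × Fin n)
petersenEnds n k (fz , i) = ((fz , i) , (fz , addMod i 1))
petersenEnds n k (fs fz , i) =
  ((fs fz , i) , (fs fz , addMod i k))
petersenEnds n k (fs (fs fz) , i) =
  ((fz , i) , (fs fz , i))

Petersen : (n k : ℕ) .{{_ : NonZero n}} → Graph
Petersen n k = record
  { V    = Fin 2 × Fin n
  ; E    = 3 * n
  ; ends = λ e → petersenEnds n k (remQuot {3} n e)
  }

module Submission where

-- Colouring the vertices by σ : V → Bool (switching) and deleting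
-- the edges whose sign disagrees with the colours of their ends always leaves
-- a balanced signed graph, since around a cycle the colour changes an even
-- number of times.  For P_{2m+1,2} the set I = {u_1, u_3, …, u_{2m-1}, v_0} is
-- independent and P_{2m+1,2} − I is a spanning tree; colour the tree so that
-- all its edges are satisfied and each vertex of I (of degree 3) by majority.
-- Then only edges at I can be frustrated, at most one per vertex of I: m + 1.
--
-- With all edges negative, the n pentagons
-- u_i u_{i+1} u_{i+2} v_{i+2} v_i of P_{n,2} are negative, so a balancing set
-- meets each of them; every edge lies on at most two, hence n ≤ 2 ∣S∣.

open import Defs
open import Data.Nat using (ℕ; zero; suc; _+_; _*_; _∸_; _≤_; _<_; z≤n; s≤s; NonZero)
open import Data.Nat.Properties
open import Data.Nat.DivMod using (_%_; m%n<n; m<n⇒m%n≡m; [m+n]%n≡m%n; m*n%n≡0; [m+kn]%n≡m%n; %-distribˡ-+; m%n%n≡m%n)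
open import Data.Bool using (Bool; true; false; _xor_; _∧_; if_then_else_)
open import Data.Bool.Properties using (xor-assoc; xor-comm; xor-same)
open import Data.Fin using (Fin; toℕ; fromℕ<; combine) renaming (zero to fz; suc to fs)
open import Data.Fin.Properties using (toℕ<n; toℕ-fromℕ<; fromℕ<-toℕ; fromℕ<-cong; toℕ-injective; remQuot-combine)
open import Data.Fin.Subset using (Subset; _∉_; ∣_∣; ⊤)
open import Data.Fin.Subset.Properties using (_∈?_)
open import Data.Vec using (_∷_; []; lookup; tabulate)
open import Data.Vec.Properties using (lookup∘tabulate; lookup⇒[]=; []=⇒lookup; lookup-replicate)
open import Data.List using (map; allFin)
open import Data.List.Properties using (map-tabulate)
import Data.List as List
open import Data.Nat.ListAction using () renaming (sum to listSum)
open import Data.Product using (Σ; _×_; _,_; proj₁; proj₂)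
open import Data.Sum using (inj₁; inj₂)
open import Relation.Nullary.Decidable using (⌊_⌋; isYes≗does)
open import Function using (_∘_)
open import Relation.Binary.PropositionalEquality
open import Data.Empty using (⊥-elim)
open import Relation.Nullary using (¬_)
open import Data.Fin.Patterns using (0F; 1F; 2F; 3F; 4F)
open import Data.Nat.Tactic.RingSolver using (solve-∀)
open import Algebra.Properties.CommutativeMonoid.Sum +-0-commutativeMonoid
  using (sum; sum-syntax; sum-cong-≗; sum-replicate-zero; ∑-distrib-+; ∑-comm)

ind : Bool → ℕ
ind b = if b then 1 else 0

-- Sums over an initial segment of ℕ, defined through the Fin-indexed sum
-- so that  ∑ℕ (suc n) f  unfolds definitionally to  f 0 + ∑ℕ n (f ∘ suc).
∑ℕ : ℕ → (ℕ → ℕ) → ℕ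
∑ℕ n f = ∑[ i < n ] f (toℕ i)

∑-mono : ∀ {n} {F G : Fin n → ℕ} → (∀ i → F i ≤ G i) → ∑[ i < n ] F i ≤ ∑[ i < n ] G i
∑-mono {zero}  le = z≤n
∑-mono {suc n} le = +-mono-≤ (le fz) (∑-mono (le ∘ fs))

∑-zero⇒zero : ∀ {n} (F : Fin n → ℕ) → ∑[ i < n ] F i ≡ 0 → ∀ i → F i ≡ 0
∑-zero⇒zero F eq fz     = m+n≡0⇒m≡0 (F fz) eq
∑-zero⇒zero F eq (fs i) = ∑-zero⇒zero (F ∘ fs) (m+n≡0⇒n≡0 (F fz) eq) i

∑ℕ-cong : ∀ n {f g : ℕ → ℕ} → (∀ i → i < n → f i ≡ g i) → ∑ℕ n f ≡ ∑ℕ n g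
∑ℕ-cong n eq = sum-cong-≗ (λ i → eq (toℕ i) (toℕ<n i))

∑ℕ-mono : ∀ n {f g : ℕ → ℕ} → (∀ i → i < n → f i ≤ g i) → ∑ℕ n f ≤ ∑ℕ n g
∑ℕ-mono n le = ∑-mono (λ i → le (toℕ i) (toℕ<n i))

∑ℕ-+ : ∀ n (f g : ℕ → ℕ) → ∑ℕ n (λ i → f i + g i) ≡ ∑ℕ n f + ∑ℕ n g
∑ℕ-+ n f g = ∑-distrib-+ {n} (f ∘ toℕ) (g ∘ toℕ)

∑ℕ-zero : ∀ n {f : ℕ → ℕ} → (∀ i → i < n → f i ≡ 0) → ∑ℕ n f ≡ 0
∑ℕ-zero n eq = trans (∑ℕ-cong n eq) (sum-replicate-zero n)

∑ℕ-ones : ∀ n → ∑ℕ n (λ _ → 1) ≡ n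
∑ℕ-ones zero    = refl
∑ℕ-ones (suc n) = cong suc (∑ℕ-ones n)

∑ℕ-last : ∀ n (f : ℕ → ℕ) → ∑ℕ (suc n) f ≡ ∑ℕ n f + f n
∑ℕ-last zero    f = +-comm (f 0) 0
∑ℕ-last (suc n) f = trans (cong (f 0 +_) (∑ℕ-last n (f ∘ suc))) (sym (+-assoc (f 0) _ _))

∑ℕ-rotate : ∀ n (f : ℕ → ℕ) → f n ≡ f 0 → ∑ℕ n (f ∘ suc) ≡ ∑ℕ n f
∑ℕ-rotate n f wrap = +-cancelˡ-≡ (f 0) _ _ (begin
    f 0 + ∑ℕ n (f ∘ suc)   ≡⟨ ∑ℕ-last n f ⟩
    ∑ℕ n f + f n           ≡⟨ cong (∑ℕ n f +_) wrap ⟩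
    ∑ℕ n f + f 0           ≡⟨ +-comm (∑ℕ n f) (f 0) ⟩
    f 0 + ∑ℕ n f           ∎)
  where open ≡-Reasoning

-- Doubling, defined so that  twice (suc t)  unfolds to  suc (suc (twice t)).
twice : ℕ → ℕ
twice zero    = zero
twice (suc t) = suc (suc (twice t))

twice≡2* : ∀ t → twice t ≡ 2 * t
twice≡2* zero    = refl
twice≡2* (suc t) = trans (cong (suc ∘ suc) (twice≡2* t)) (sym (*-suc 2 t))

twice-mono : ∀ {t u} → t ≤ u → twice t ≤ twice u
twice-mono z≤n       = z≤n
twice-mono (s≤s t≤u) = s≤s (s≤s (twice-mono t≤u))

∑ℕ-pairs : ∀ m (f : ℕ → ℕ) → ∑ℕ (twice m) f ≡ ∑ℕ m (λ t → f (twice t) + f (suc (twice t)))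
∑ℕ-pairs zero    f = refl
∑ℕ-pairs (suc m) f =
  trans (sym (+-assoc (f 0) (f 1) _)) (cong (f 0 + f 1 +_) (∑ℕ-pairs m (f ∘ suc ∘ suc)))

interleave : {A : Set} → (ℕ → A) → (ℕ → A) → ℕ → A
interleave e o zero          = e 0
interleave e o (suc zero)    = o 0
interleave e o (suc (suc i)) = interleave (e ∘ suc) (o ∘ suc) i

interleave-even : {A : Set} (e o : ℕ → A) (t : ℕ) → interleave e o (twice t) ≡ e t
interleave-even e o zero    = refl
interleave-even e o (suc t) = interleave-even (e ∘ suc) (o ∘ suc) t

interleave-odd : {A : Set} (e o : ℕ → A) (t : ℕ) → interleave e o (suc (twice t)) ≡ o t
interleave-odd e o zero    = refl
interleave-odd e o (suc t) = interleave-odd (e ∘ suc) (o ∘ suc) t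

atMod : {A : Set} {N : ℕ} .{{_ : NonZero N}} → (Fin N → A) → ℕ → A
atMod {N = N} h x = h (fromℕ< (m%n<n x N))

atMod-toℕ : {A : Set} {N : ℕ} .{{_ : NonZero N}} (h : Fin N → A) (i : Fin N) →
            atMod h (toℕ i) ≡ h i
atMod-toℕ {N = N} h i = cong h (trans
  (fromℕ<-cong _ _ (m<n⇒m%n≡m (toℕ<n i)) (m%n<n (toℕ i) N) (toℕ<n i))
  (fromℕ<-toℕ i (toℕ<n i)))

atMod-period : {A : Set} {N : ℕ} .{{_ : NonZero N}} (h : Fin N → A) (x : ℕ) →
               atMod h (N + x) ≡ atMod h x
atMod-period {N = N} h x = cong h (fromℕ<-cong _ _
  (trans (cong (_% N) (+-comm N x)) ([m+n]%n≡m%n x N)) (m%n<n (N + x) N) (m%n<n x N))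

∑-atMod : {N : ℕ} .{{_ : NonZero N}} (h : Fin N → ℕ) → ∑ℕ N (atMod h) ≡ sum h
∑-atMod h = sum-cong-≗ (atMod-toℕ h)

∑-atMod-shift : {N : ℕ} .{{_ : NonZero N}} (h : Fin N → ℕ) (d : ℕ) →
                ∑ℕ N (λ x → atMod h (x + d)) ≡ sum h
∑-atMod-shift {N} h zero =
  trans (∑ℕ-cong N (λ x _ → cong (atMod h) (+-identityʳ x))) (∑-atMod h)
∑-atMod-shift {N} h (suc d) = begin
    ∑ℕ N (λ x → atMod h (x + suc d))    ≡⟨ ∑ℕ-cong N (λ x _ → cong (atMod h) (+-suc x d)) ⟩
    ∑ℕ N (λ x → atMod h (suc x + d))    ≡⟨ ∑ℕ-rotate N (λ x → atMod h (x + d)) (atMod-period h d) ⟩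
    ∑ℕ N (λ x → atMod h (x + d))        ≡⟨ ∑-atMod-shift h d ⟩
    sum h                               ∎
  where open ≡-Reasoning

∑-atMod-next : {N : ℕ} .{{_ : NonZero N}} (h : Fin N → ℕ) → ∑ℕ N (atMod h ∘ suc) ≡ sum h
∑-atMod-next {N} h = trans (∑ℕ-rotate N (atMod h) wrap) (∑-atMod h)
  where
  wrap : atMod h N ≡ atMod h 0
  wrap = trans (cong (atMod h) (sym (+-identityʳ N))) (atMod-period h 0)

%-absorbˡ : ∀ {n} .{{_ : NonZero n}} a b → (a % n + b) % n ≡ (a + b) % n
%-absorbˡ {n} a b = begin
    (a % n + b) % n          ≡⟨ %-distribˡ-+ (a % n) b n ⟩
    (a % n % n + b % n) % n  ≡⟨ cong (λ r → (r + b % n) % n) (m%n%n≡m%n a n) ⟩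
    (a % n + b % n) % n      ≡⟨ %-distribˡ-+ a b n ⟨
    (a + b) % n              ∎
  where open ≡-Reasoning

toℕ-addMod : ∀ {n} .{{_ : NonZero n}} (i : Fin n) d → toℕ (addMod i d) ≡ (toℕ i + d) % n
toℕ-addMod i d = toℕ-fromℕ< _

addMod-addMod : ∀ {n} .{{_ : NonZero n}} (i : Fin n) d e → addMod (addMod i d) e ≡ addMod i (d + e)
addMod-addMod {n} i d e = toℕ-injective (begin
    toℕ (addMod (addMod i d) e)    ≡⟨ toℕ-addMod (addMod i d) e ⟩
    (toℕ (addMod i d) + e) % n     ≡⟨ cong (λ r → (r + e) % n) (toℕ-addMod i d) ⟩
    ((toℕ i + d) % n + e) % n      ≡⟨ %-absorbˡ (toℕ i + d) e ⟩
    (toℕ i + d + e) % n            ≡⟨ cong (_% n) (+-assoc (toℕ i) d e) ⟩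
    (toℕ i + (d + e)) % n          ≡⟨ toℕ-addMod i (d + e) ⟨
    toℕ (addMod i (d + e))         ∎)
  where open ≡-Reasoning

addMod-injective : ∀ {n} .{{_ : NonZero n}} (i : Fin n) {d e} → d < n → e < n →
                   addMod i d ≡ addMod i e → d ≡ e
addMod-injective {n} i {d} {e} d<n e<n eq = begin
    d                               ≡⟨ recover d d<n ⟨
    ((x + d) % n + (n ∸ x)) % n     ≡⟨ cong (λ r → (r + (n ∸ x)) % n) positions ⟩
    ((x + e) % n + (n ∸ x)) % n     ≡⟨ recover e e<n ⟩
    e                               ∎
  where
  open ≡-Reasoning
  x : ℕ
  x = toℕ i
  positions : (x + d) % n ≡ (x + e) % n
  positions = trans (sym (toℕ-addMod i d)) (trans (cong toℕ eq) (toℕ-addMod i e))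
  recover : ∀ r → r < n → ((x + r) % n + (n ∸ x)) % n ≡ r
  recover r r<n = begin
    ((x + r) % n + (n ∸ x)) % n     ≡⟨ %-absorbˡ (x + r) (n ∸ x) ⟩
    (x + r + (n ∸ x)) % n           ≡⟨ cong (λ z → (z + (n ∸ x)) % n) (+-comm x r) ⟩
    (r + x + (n ∸ x)) % n           ≡⟨ cong (_% n) (+-assoc r x (n ∸ x)) ⟩
    (r + (x + (n ∸ x))) % n         ≡⟨ cong (λ z → (r + z) % n) (m+[n∸m]≡n (<⇒≤ (toℕ<n i))) ⟩
    (r + n) % n                     ≡⟨ [m+n]%n≡m%n r n ⟩
    r % n                           ≡⟨ m<n⇒m%n≡m r<n ⟩
    r                               ∎

listSum-allFin : ∀ N (F : Fin N → ℕ) → listSum (map F (allFin N)) ≡ ∑[ i < N ] F i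
listSum-allFin N F = trans (cong listSum (map-tabulate (λ i → i) F)) (tabulated N F)
  where
  tabulated : ∀ N (F : Fin N → ℕ) → listSum (List.tabulate F) ≡ ∑[ i < N ] F i
  tabulated zero    F = refl
  tabulated (suc N) F = cong (F fz +_) (tabulated N (F ∘ fs))

∣∣-sum : ∀ {N} (p : Subset N) → ∣ p ∣ ≡ ∑[ e < N ] ind (lookup p e)
∣∣-sum []          = refl
∣∣-sum (true ∷ p)  = cong suc (∣∣-sum p)
∣∣-sum (false ∷ p) = ∣∣-sum p

∈?-lookup : ∀ {N} (e : Fin N) (p : Subset N) → ⌊ e ∈? p ⌋ ≡ lookup p e
∈?-lookup fz     (true ∷ p)  = refl
∈?-lookup fz     (false ∷ p) = refl
∈?-lookup (fs e) (b ∷ p)     =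
  trans (isYes≗does (fs e ∈? (b ∷ p))) (trans (sym (isYes≗does (e ∈? p))) (∈?-lookup e p))

∑-combine : ∀ t n (F : Fin (t * n) → ℕ) →
            ∑[ e < t * n ] F e ≡ ∑[ s < t ] ∑[ i < n ] F (combine s i)
∑-combine zero    n F = refl
∑-combine (suc t) n F = trans (∑-append n (t * n) F)
        (cong (∑[ i < n ] F (i ↑ˡ t * n) +_) (∑-combine t n (F ∘ (n ↑ʳ_))))
  where
  open Data.Fin using (_↑ˡ_; _↑ʳ_)
  ∑-append : ∀ a b (F : Fin (a + b) → ℕ) →
             ∑[ e < a + b ] F e ≡ ∑[ i < a ] F (i ↑ˡ b) + ∑[ j < b ] F (a ↑ʳ j)
  ∑-append zero    b F = refl
  ∑-append (suc a) b F = trans (cong (F fz +_) (∑-append a b (F ∘ fs))) (sym (+-assoc (F fz) _ _))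

-- The cost of an edge of sign s (true = negative) whose ends carry the
-- switching values p and q: 1 exactly when the edge is negative after switching.
edgeCost : Bool → Bool → Bool → ℕ
edgeCost s p q = ind (s xor (p xor q))

edgeCost-sym : ∀ s p q → edgeCost s p q ≡ edgeCost s q p
edgeCost-sym s p q = cong (λ r → ind (s xor r)) (xor-comm p q)

-- Seen from the end q, the edge asks for the value  p xor s.
edgeCost-wish : ∀ s p q → edgeCost s p q ≡ ind ((p xor s) xor q)
edgeCost-wish s p q =
  cong ind (trans (sym (xor-assoc s p q)) (cong (_xor q) (xor-comm s p)))

edgeCost-satisfied : ∀ s p q → q ≡ p xor s → edgeCost s p q ≡ 0
edgeCost-satisfied s p q refl = trans (edgeCost-wish s p q) (cong ind (xor-same (p xor s)))

maj : Bool → Bool → Bool → Bool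
maj x y z = if x xor y then z else x

majority-cost : ∀ x y z →
  ind (x xor maj x y z) + ind (y xor maj x y z) + ind (z xor maj x y z) ≤ 1
majority-cost true  true  true  = z≤n
majority-cost true  true  false = s≤s z≤n
majority-cost false false true  = s≤s z≤n
majority-cost false false false = z≤n
majority-cost true  false true  = s≤s z≤n
majority-cost true  false false = s≤s z≤n
majority-cost false true  true  = s≤s z≤n
majority-cost false true  false = s≤s z≤n

star-cost : ∀ s₁ p₁ s₂ p₂ s₃ p₃ →
  let q = maj (p₁ xor s₁) (p₂ xor s₂) (p₃ xor s₃) in
  edgeCost s₁ p₁ q + edgeCost s₂ p₂ q + edgeCost s₃ p₃ q ≤ 1
star-cost s₁ p₁ s₂ p₂ s₃ p₃ = subst (_≤ 1)
  (sym (cong₂ _+_ (cong₂ _+_ (edgeCost-wish s₁ p₁ _) (edgeCost-wish s₂ p₂ _)) (edgeCost-wish s₃ p₃ _)))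
  (majority-cost (p₁ xor s₁) (p₂ xor s₂) (p₃ xor s₃))

-- Along a closed sequence of bits, the bit changes an even number of times:
-- ind (x ⊕ y) + 2·ind (x ∧ y) = ind x + ind y, summed around the cycle.
changes-even : ∀ L (x : Fin (suc L) → Bool) →
               (∑[ i < suc L ] ind (x i xor x (next i))) % 2 ≡ 0
changes-even L x = begin
    T % 2                ≡⟨ [m+kn]%n≡m%n T P 2 ⟨
    (T + P * 2) % 2      ≡⟨ cong (_% 2) changes+meets ⟩
    (Q * 2) % 2          ≡⟨ m*n%n≡0 Q 2 ⟩
    0                    ∎
  where
  open ≡-Reasoning
  N T P Q : ℕ
  N = suc L
  change meet : Fin N → ℕ
  change i = ind (x i xor x (next i))
  meet   i = ind (x i ∧ x (next i))
  T = ∑[ i < N ] change i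
  P = ∑[ i < N ] meet i
  Q = ∑[ i < N ] ind (x i)
  double : ∀ a → a + a ≡ a * 2
  double a = trans (cong (a +_) (sym (+-identityʳ a))) (*-comm 2 a)
  pointwise : ∀ a b → ind (a xor b) + (ind (a ∧ b) + ind (a ∧ b)) ≡ ind a + ind b
  pointwise true  true  = refl
  pointwise true  false = refl
  pointwise false true  = refl
  pointwise false false = refl
  changes+meets : T + P * 2 ≡ Q * 2
  changes+meets = begin
    T + P * 2                                       ≡⟨ cong (T +_) (double P) ⟨
    T + (P + P)                                     ≡⟨ cong (T +_) (∑-distrib-+ meet meet) ⟨
    T + ∑[ i < N ] (meet i + meet i)                ≡⟨ ∑-distrib-+ change (λ i → meet i + meet i) ⟨
    ∑[ i < N ] (change i + (meet i + meet i))       ≡⟨ sum-cong-≗ (λ i → pointwise (x i) (x (next i))) ⟩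
    ∑[ i < N ] (ind (x i) + ind (x (next i)))       ≡⟨ ∑-distrib-+ (ind ∘ x) (λ i → ind (x (next i))) ⟩
    Q + ∑[ i < N ] ind (x (next i))                 ≡⟨ cong (Q +_) (∑-atMod-next (ind ∘ x)) ⟩
    Q + Q                                           ≡⟨ double Q ⟩
    Q * 2                                           ∎

∉⇒lookup-false : ∀ {N} (p : Subset N) (e : Fin N) → e ∉ p → lookup p e ≡ false
∉⇒lookup-false p e e∉p with lookup p e in eq
... | true  = ⊥-elim (e∉p (lookup⇒[]= e p eq))
... | false = refl

xor-false⇒≡ : ∀ s r → s xor r ≡ false → s ≡ r
xor-false⇒≡ true  true  _ = refl
xor-false⇒≡ false false _ = refl

frustratedEdges : (G : Graph) → Subset (E G) → (V G → Bool) → Subset (E G)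
frustratedEdges G Eneg σ =
  tabulate λ e → lookup Eneg e xor (σ (proj₁ (ends G e)) xor σ (proj₂ (ends G e)))

frustratedEdges-ind : (G : Graph) (Eneg : Subset (E G)) (σ : V G → Bool) (e : Fin (E G)) →
  ind (lookup (frustratedEdges G Eneg σ) e)
    ≡ edgeCost (lookup Eneg e) (σ (proj₁ (ends G e))) (σ (proj₂ (ends G e)))
frustratedEdges-ind G Eneg σ e = cong ind (lookup∘tabulate _ e)

negCount-sum : (G : Graph) (Eneg : Subset (E G)) (C : Cycle G) →
               negCount G Eneg C ≡ ∑[ i < suc (L C) ] ind (lookup Eneg (edge C i))
negCount-sum G Eneg C =
  trans (listSum-allFin (suc (L C)) (λ i → ind ⌊ edge C i ∈? Eneg ⌋))
        (sum-cong-≗ (λ i → cong ind (∈?-lookup (edge C i) Eneg)))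

-- Deleting the frustrated edges of any switching leaves a balanced signed
-- graph: on a surviving cycle the negative edges are exactly the places where
-- the colour changes, and a closed walk changes colour an even number of times.
deleting-frustrated-balances : (G : Graph) (Eneg : Subset (E G)) (σ : V G → Bool) →
  BalancedAfterDeleting G Eneg (frustratedEdges G Eneg σ)
deleting-frustrated-balances G Eneg σ C avoids = begin
    negCount G Eneg C % 2                          ≡⟨ cong (_% 2) (negCount-sum G Eneg C) ⟩
    (∑[ i < N ] ind (lookup Eneg (edge C i))) % 2   ≡⟨ cong (_% 2) (sum-cong-≗ sign-is-change) ⟩
    (∑[ i < N ] ind (x i xor x (next i))) % 2      ≡⟨ changes-even (L C) x ⟩
    0                                              ∎
  where
  open ≡-Reasoning
  N : ℕ
  N = suc (L C)
  x : Fin N → Bool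
  x = σ ∘ vert C
  sign-agrees : ∀ i → lookup Eneg (edge C i)
                      ≡ σ (proj₁ (ends G (edge C i))) xor σ (proj₂ (ends G (edge C i)))
  sign-agrees i = xor-false⇒≡ _ _ (trans (sym (lookup∘tabulate _ (edge C i)))
                                         (∉⇒lookup-false _ (edge C i) (avoids i)))
  sign-is-change : ∀ i → ind (lookup Eneg (edge C i)) ≡ ind (x i xor x (next i))
  sign-is-change i with joins C i
  ... | inj₁ forward  = cong ind (trans (sign-agrees i)
                          (cong (λ ab → σ (proj₁ ab) xor σ (proj₂ ab)) forward))
  ... | inj₂ backward = cong ind (trans (sign-agrees i)
                          (trans (cong (λ ab → σ (proj₁ ab) xor σ (proj₂ ab)) backward)
                                 (xor-comm (x (next i)) (x i))))

maxFrustration-from-bounds : (G : Graph) (d : ℕ) (Eneg₀ : Subset (E G)) →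
  ((Eneg : Subset (E G)) → Σ (Subset (E G)) λ S → BalancedAfterDeleting G Eneg S × ∣ S ∣ ≤ d) →
  ((S : Subset (E G)) → BalancedAfterDeleting G Eneg₀ S → d ≤ ∣ S ∣) →
  IsMaxFrustration G d
maxFrustration-from-bounds G d Eneg₀ upper lower =
  (Eneg₀ , (S₀ , ≤-antisym ∣S₀∣≤d (lower S₀ balanced₀) , balanced₀) , lower) , atMost-d
  where
  S₀ : Subset (E G)
  S₀ = proj₁ (upper Eneg₀)
  balanced₀ : BalancedAfterDeleting G Eneg₀ S₀
  balanced₀ = proj₁ (proj₂ (upper Eneg₀))
  ∣S₀∣≤d : ∣ S₀ ∣ ≤ d
  ∣S₀∣≤d = proj₂ (proj₂ (upper Eneg₀))
  atMost-d : (Eneg : Subset (E G)) (l : ℕ) → IsFrustrationIndex G Eneg l → l ≤ d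
  atMost-d Eneg l (_ , minimal) with upper Eneg
  ... | S , balanced , ∣S∣≤d = ≤-trans (minimal S balanced) ∣S∣≤d

negCount-allNegative : (G : Graph) (C : Cycle G) → negCount G ⊤ C ≡ suc (L C)
negCount-allNegative G C = trans (negCount-sum G ⊤ C)
  (trans (sum-cong-≗ (λ i → cong ind (lookup-replicate (edge C i) true))) (∑ℕ-ones (suc (L C))))

module PetersenEdges (n k : ℕ) .{{_ : NonZero n}} where

  edgeAt : Fin 3 → Fin n → Fin (3 * n)
  edgeAt = combine

  outer inner spoke : Fin n → Fin (3 * n)
  outer = edgeAt 0F
  inner = edgeAt 1F
  spoke = edgeAt 2F

  ends-edgeAt : ∀ t i → ends (Petersen n k) (edgeAt t i) ≡ petersenEnds n k (t , i)
  ends-edgeAt t i = cong (petersenEnds n k) (remQuot-combine t i)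

  ∣∣-by-family : (S : Subset (3 * n)) →
    ∣ S ∣ ≡ ∑[ i < n ] ind (lookup S (outer i))
            + (∑[ i < n ] ind (lookup S (inner i)) + ∑[ i < n ] ind (lookup S (spoke i)))
  ∣∣-by-family S = trans (∣∣-sum S) (trans (∑-combine 3 n (λ e → ind (lookup S e)))
    (cong (λ z → ∑[ i < n ] ind (lookup S (outer i)) + (∑[ i < n ] ind (lookup S (inner i)) + z))
          (+-identityʳ _)))

  outerSign innerSign spokeSign : Subset (3 * n) → ℕ → Bool
  outerSign Eneg = atMod (λ i → lookup Eneg (outer i))
  innerSign Eneg = atMod (λ i → lookup Eneg (inner i))
  spokeSign Eneg = atMod (λ i → lookup Eneg (spoke i))

  switchingCost : (a b c X Y : ℕ → Bool) → ℕ
  switchingCost a b c X Y =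
      ∑ℕ n (λ i → edgeCost (a i) (X i) (X ((i + 1) % n)))
    + (∑ℕ n (λ i → edgeCost (b i) (Y i) (Y ((i + k) % n)))
    + ∑ℕ n (λ i → edgeCost (c i) (X i) (Y i)))

  switching-balances : (Eneg : Subset (3 * n)) (X Y : ℕ → Bool) →
    Σ (Subset (3 * n)) λ S → BalancedAfterDeleting (Petersen n k) Eneg S
      × ∣ S ∣ ≡ switchingCost (outerSign Eneg) (innerSign Eneg) (spokeSign Eneg) X Y
  switching-balances Eneg X Y =
    S , deleting-frustrated-balances (Petersen n k) Eneg σ ,
    trans (∣∣-by-family S) (cong₂ _+_ (sum-cong-≗ outer-cost)
                                     (cong₂ _+_ (sum-cong-≗ inner-cost) (sum-cong-≗ spoke-cost)))
    where
    σ : Fin 2 × Fin n → Bool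
    σ (0F , i) = X (toℕ i)
    σ (1F , i) = Y (toℕ i)
    S : Subset (3 * n)
    S = frustratedEdges (Petersen n k) Eneg σ
    cost-at : ∀ t i → ind (lookup S (edgeAt t i))
      ≡ edgeCost (lookup Eneg (edgeAt t i)) (σ (proj₁ (petersenEnds n k (t , i))))
                                            (σ (proj₂ (petersenEnds n k (t , i))))
    cost-at t i = trans (frustratedEdges-ind (Petersen n k) Eneg σ (edgeAt t i))
      (cong (λ ab → edgeCost (lookup Eneg (edgeAt t i)) (σ (proj₁ ab)) (σ (proj₂ ab)))
            (ends-edgeAt t i))
    outer-cost : ∀ i → ind (lookup S (outer i))
      ≡ edgeCost (outerSign Eneg (toℕ i)) (X (toℕ i)) (X ((toℕ i + 1) % n))
    outer-cost i = trans (cost-at 0F i) (cong₂ (λ s x → edgeCost s (X (toℕ i)) (X x))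
      (sym (atMod-toℕ (lookup Eneg ∘ outer) i)) (toℕ-fromℕ< _))
    inner-cost : ∀ i → ind (lookup S (inner i))
      ≡ edgeCost (innerSign Eneg (toℕ i)) (Y (toℕ i)) (Y ((toℕ i + k) % n))
    inner-cost i = trans (cost-at 1F i) (cong₂ (λ s y → edgeCost s (Y (toℕ i)) (Y y))
      (sym (atMod-toℕ (lookup Eneg ∘ inner) i)) (toℕ-fromℕ< _))
    spoke-cost : ∀ i → ind (lookup S (spoke i))
      ≡ edgeCost (spokeSign Eneg (toℕ i)) (X (toℕ i)) (Y (toℕ i))
    spoke-cost i = trans (cost-at 2F i)
      (cong (λ s → edgeCost s (X (toℕ i)) (Y (toℕ i))) (sym (atMod-toℕ (lookup Eneg ∘ spoke) i)))

-- Lower bound: under the all-negative signature, P_{n,2} (n ≥ 3) contains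
-- the n negative pentagons  u_i u_{i+1} u_{i+2} v_{i+2} v_i , and every edge
-- lies on at most two of them.

module Pentagons (n : ℕ) .{{_ : NonZero n}} (2<n : 2 < n) where
  open PetersenEdges n 2

  G : Graph
  G = Petersen n 2

  -- the j-th pentagon vertex lies in  layer j  at position  i + offset j
  layer : Fin 5 → Fin 2
  layer 0F = 0F
  layer 1F = 0F
  layer 2F = 0F
  layer 3F = 1F
  layer 4F = 1F

  offset : Fin 5 → ℕ
  offset 0F = 0
  offset 1F = 1
  offset 2F = 2
  offset 3F = 2
  offset 4F = 0

  offset<n : ∀ j → offset j < n
  offset<n 0F = ≤-trans (s≤s z≤n) 2<n
  offset<n 1F = ≤-trans (s≤s (s≤s z≤n)) 2<n
  offset<n 2F = 2<n
  offset<n 3F = 2<n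
  offset<n 4F = ≤-trans (s≤s z≤n) 2<n

  fromShape : Fin 2 × ℕ → Fin 5
  fromShape (0F , 0) = 0F
  fromShape (0F , 1) = 1F
  fromShape (0F , _) = 2F
  fromShape (1F , 0) = 4F
  fromShape (1F , _) = 3F

  fromShape-shape : ∀ j → fromShape (layer j , offset j) ≡ j
  fromShape-shape 0F = refl
  fromShape-shape 1F = refl
  fromShape-shape 2F = refl
  fromShape-shape 3F = refl
  fromShape-shape 4F = refl

  -- the j-th pentagon edge is of family  family j  at position  i + edgeOffset j
  family : Fin 5 → Fin 3
  family 0F = 0F
  family 1F = 0F
  family 2F = 2F
  family 3F = 1F
  family 4F = 2F

  edgeOffset : Fin 5 → ℕ
  edgeOffset 0F = 0
  edgeOffset 1F = 1
  edgeOffset 2F = 2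
  edgeOffset 3F = 0
  edgeOffset 4F = 0

  pentagon : Fin n → Cycle G
  pentagon i = record
    { L        = 4
    ; long     = s≤s (s≤s z≤n)
    ; vert     = vertex
    ; distinct = vertex-injective
    ; edge     = λ j → edgeAt (family j) (addMod i (edgeOffset j))
    ; joins    = consecutive
    }
    where
    vertex : Fin 5 → Fin 2 × Fin n
    vertex j = layer j , addMod i (offset j)
    vertex-injective : ∀ {j j′} → vertex j ≡ vertex j′ → j ≡ j′
    vertex-injective {j} {j′} eq = begin
      j                                ≡⟨ fromShape-shape j ⟨
      fromShape (layer j , offset j)    ≡⟨ cong fromShape (cong₂ _,_ (cong proj₁ eq)
                                             (addMod-injective i (offset<n j) (offset<n j′) (cong proj₂ eq))) ⟩
      fromShape (layer j′ , offset j′)  ≡⟨ fromShape-shape j′ ⟩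
      j′                               ∎
      where open ≡-Reasoning
    consecutive : ∀ j → Joins G (edgeAt (family j) (addMod i (edgeOffset j))) (vertex j) (vertex (next j))
    consecutive 0F = inj₁ (trans (ends-edgeAt 0F (addMod i 0))
                 (cong (λ p → (0F , addMod i 0) , (0F , p)) (addMod-addMod i 0 1)))
    consecutive 1F = inj₁ (trans (ends-edgeAt 0F (addMod i 1))
                 (cong (λ p → (0F , addMod i 1) , (0F , p)) (addMod-addMod i 1 1)))
    consecutive 2F = inj₁ (ends-edgeAt 2F (addMod i 2))
    consecutive 3F = inj₂ (trans (ends-edgeAt 1F (addMod i 0))
                 (cong (λ p → (1F , addMod i 0) , (1F , p)) (addMod-addMod i 0 2)))
    consecutive 4F = inj₂ (ends-edgeAt 2F (addMod i 0))

  pentagon-hit : (S : Subset (3 * n)) → BalancedAfterDeleting G ⊤ S →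
                 ∀ i → 1 ≤ ∑[ j < 5 ] ind (lookup S (edge (pentagon i) j))
  pentagon-hit S balanced i = n≢0⇒n>0 λ missed → odd-length (balanced (pentagon i) (avoids missed))
    where
    avoids : ∑[ j < 5 ] ind (lookup S (edge (pentagon i) j)) ≡ 0 → ∀ j → edge (pentagon i) j ∉ S
    avoids missed j e∈S = 1≢0 (trans (cong ind (sym ([]=⇒lookup e∈S)))
                                     (∑-zero⇒zero (λ j → ind (lookup S (edge (pentagon i) j))) missed j))
      where
      1≢0 : 1 ≢ 0
      1≢0 ()
    -- all five edges are negative, and 5 is odd
    odd-length : ¬ Positive G ⊤ (pentagon i)
    odd-length positive =
      five-odd (trans (sym (cong (_% 2) (negCount-allNegative G (pentagon i)))) positive)
      where
      five-odd : 5 % 2 ≢ 0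
      five-odd ()

  -- summing over all n pentagons counts outer edges and spokes twice and
  -- inner edges once, hence  n ≤ 2 ∣S∣
  lower-bound : (S : Subset (3 * n)) → BalancedAfterDeleting G ⊤ S → n ≤ 2 * ∣ S ∣
  lower-bound S balanced = begin
    n                                                   ≡⟨ ∑ℕ-ones n ⟨
    ∑[ i < n ] 1                                        ≤⟨ ∑-mono (pentagon-hit S balanced) ⟩
    ∑[ i < n ] ∑[ j < 5 ] hit i j                       ≡⟨ ∑-comm hit ⟩
    ∑[ j < 5 ] ∑[ i < n ] hit i j
      ≡⟨ sum-cong-≗ (λ j → ∑-atMod-shift (members (family j)) (edgeOffset j)) ⟩
    ∑[ j < 5 ] count (family j)                         ≤⟨ m≤m+n _ (count 1F) ⟩
    ∑[ j < 5 ] count (family j) + count 1F              ≡⟨ twice-each (count 0F) (count 1F) (count 2F) ⟨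
    2 * (count 0F + (count 1F + count 2F))              ≡⟨ cong (2 *_) (∣∣-by-family S) ⟨
    2 * ∣ S ∣                                           ∎
    where
    open ≤-Reasoning
    hit : Fin n → Fin 5 → ℕ
    hit i j = ind (lookup S (edge (pentagon i) j))
    members : Fin 3 → Fin n → ℕ
    members t i = ind (lookup S (edgeAt t i))
    count : Fin 3 → ℕ
    count t = ∑[ i < n ] members t i
    twice-each : ∀ a b c → 2 * (a + (b + c)) ≡ a + (a + (c + (b + (c + 0)))) + b
    twice-each = solve-∀

-- The set  I = {u_1, u_3, …, u_{2m-1}, v_0}  is independent and P_{2m+1,2} − I
-- is a spanning tree: the inner path  v_2 v_4 … v_{2m} v_1 v_3 … v_{2m-1}
-- with the spokes u_{2t}v_{2t} (t ≥ 1) and the outer edge u_{2m}u_0 attached.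
-- Colour the tree so that all its edges are satisfied, then give each vertex
-- of I the majority of the colours its three edges ask for.

module OddSwitching (k : ℕ) (a b c : ℕ → Bool) where
  m n : ℕ
  m = suc k
  n = suc (2 * m)

  open PetersenEdges n 2 using (switchingCost)

  -- colours along the inner path: innerEven t at v_{2t}, innerOdd t at v_{2t+1}
  innerEven innerOdd : ℕ → Bool
  innerEven zero    = false
  innerEven (suc t) = innerEven t xor b (twice t)
  innerOdd zero     = innerEven m xor b (twice m)
  innerOdd (suc t)  = innerOdd t xor b (suc (twice t))

  -- the colour the spoke u_{2t+2} v_{2t+2} asks for at u_{2t+2}
  spokeWish : ℕ → Bool
  spokeWish t = innerEven (suc t) xor c (twice (suc t))

  -- outerEven t at u_{2t}; u_0 hangs off u_{2m} through the outer edge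
  outerEven : ℕ → Bool
  outerEven zero    = spokeWish k xor a (twice m)
  outerEven (suc t) = spokeWish t

  -- outerOdd t at u_{2t+1} ∈ I: majority of its three wishes
  outerOdd : ℕ → Bool
  outerOdd t = maj (outerEven t xor a (twice t))
                   (outerEven (suc t) xor a (suc (twice t)))
                   (innerOdd t xor c (suc (twice t)))

  -- the colour of v_0 ∈ I: majority of its three wishes
  hub : Bool
  hub = maj (innerEven 1 xor b 0) (innerOdd k xor b (suc (twice k))) (outerEven 0 xor c 0)

  X Y : ℕ → Bool
  X = interleave outerEven outerOdd
  Y zero    = hub
  Y (suc i) = interleave innerEven innerOdd (suc i)

  outerCost innerCost spokeCost : ℕ → ℕ
  outerCost i = edgeCost (a i) (X i) (X ((i + 1) % n))
  innerCost i = edgeCost (b i) (Y i) (Y ((i + 2) % n))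
  spokeCost i = edgeCost (c i) (X i) (Y i)

  ahead : ∀ i d → d + i ≤ twice m → (i + d) % n ≡ d + i
  ahead i d d+i≤ = trans (m<n⇒m%n≡m i+d<n) (+-comm i d)
    where
    i+d<n : i + d < n
    i+d<n = subst (_< n) (+-comm d i) (s≤s (≤-trans d+i≤ (≤-reflexive (twice≡2* m))))

  wrap : ∀ i d r → i + d ≡ r + n → r < n → (i + d) % n ≡ r
  wrap i d r eq r<n = trans (cong (_% n) eq) (trans ([m+n]%n≡m%n r n) (m<n⇒m%n≡m r<n))

  outer-closing : outerCost (twice m) ≡ 0
  outer-closing = trans
    (cong₂ (edgeCost (a (twice m))) (interleave-even outerEven outerOdd m)
           (cong X (wrap (twice m) 1 0 (trans (+-comm (twice m) 1) (cong suc (twice≡2* m))) (s≤s z≤n))))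
    (edgeCost-satisfied (a (twice m)) (spokeWish k) (outerEven 0) refl)

  spoke-tree : ∀ t → spokeCost (twice (suc t)) ≡ 0
  spoke-tree t = trans
    (cong₂ (edgeCost (c (twice (suc t)))) (interleave-even outerEven outerOdd (suc t))
                                           (interleave-even innerEven innerOdd (suc t)))
    (trans (edgeCost-sym (c (twice (suc t))) (spokeWish t) (innerEven (suc t)))
           (edgeCost-satisfied (c (twice (suc t))) (innerEven (suc t)) (spokeWish t) refl))

  inner-tree-odd : ∀ t → t < k → innerCost (suc (twice t)) ≡ 0
  inner-tree-odd t t<k = trans
    (cong₂ (edgeCost (b (suc (twice t)))) (interleave-odd innerEven innerOdd t)
           (trans (cong Y (ahead (suc (twice t)) 2 (≤-trans (n≤1+n _) (twice-mono (s≤s t<k)))))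
                  (interleave-odd innerEven innerOdd (suc t))))
    (edgeCost-satisfied (b (suc (twice t))) (innerOdd t) (innerOdd (suc t)) refl)

  inner-tree-even : ∀ t → t < k → innerCost (twice (suc t)) ≡ 0
  inner-tree-even t t<k = trans
    (cong₂ (edgeCost (b (twice (suc t)))) (interleave-even innerEven innerOdd (suc t))
           (trans (cong Y (ahead (twice (suc t)) 2 (twice-mono (s≤s t<k))))
                  (interleave-even innerEven innerOdd (suc (suc t)))))
    (edgeCost-satisfied (b (twice (suc t))) (innerEven (suc t)) (innerEven (suc (suc t))) refl)

  inner-closing : innerCost (twice m) ≡ 0
  inner-closing = trans
    (cong₂ (edgeCost (b (twice m))) (interleave-even innerEven innerOdd m)
           (cong Y (wrap (twice m) 2 1 (trans (+-comm (twice m) 2) (cong (2 +_) (twice≡2* m)))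
                                       (s≤s (s≤s z≤n)))))
    (edgeCost-satisfied (b (twice m)) (innerEven m) (innerOdd 0) refl)

  star-outer : ∀ t → t < m →
               outerCost (twice t) + outerCost (suc (twice t)) + spokeCost (suc (twice t)) ≤ 1
  star-outer t t<m = subst (_≤ 1) (sym (cong₂ _+_ (cong₂ _+_ left right) spoke))
    (star-cost (a (twice t)) (outerEven t) (a (suc (twice t))) (outerEven (suc t))
               (c (suc (twice t))) (innerOdd t))
    where
    left : outerCost (twice t) ≡ edgeCost (a (twice t)) (outerEven t) (outerOdd t)
    left = cong₂ (edgeCost (a (twice t))) (interleave-even outerEven outerOdd t)
      (trans (cong X (ahead (twice t) 1 (≤-trans (n≤1+n _) (twice-mono t<m))))
             (interleave-odd outerEven outerOdd t))
    right : outerCost (suc (twice t)) ≡ edgeCost (a (suc (twice t))) (outerEven (suc t)) (outerOdd t)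
    right = trans (cong₂ (edgeCost (a (suc (twice t)))) (interleave-odd outerEven outerOdd t)
      (trans (cong X (ahead (suc (twice t)) 1 (twice-mono t<m)))
             (interleave-even outerEven outerOdd (suc t))))
      (edgeCost-sym (a (suc (twice t))) (outerOdd t) (outerEven (suc t)))
    spoke : spokeCost (suc (twice t)) ≡ edgeCost (c (suc (twice t))) (innerOdd t) (outerOdd t)
    spoke = trans (cong₂ (edgeCost (c (suc (twice t)))) (interleave-odd outerEven outerOdd t)
                                                         (interleave-odd innerEven innerOdd t))
                  (edgeCost-sym (c (suc (twice t))) (outerOdd t) (innerOdd t))

  star-hub : innerCost 0 + innerCost (suc (twice k)) + spokeCost 0 ≤ 1
  star-hub = subst (_≤ 1) (sym (cong₂ _+_ (cong₂ _+_ first last) refl))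
    (star-cost (b 0) (innerEven 1) (b (suc (twice k))) (innerOdd k) (c 0) (outerEven 0))
    where
    first : innerCost 0 ≡ edgeCost (b 0) (innerEven 1) hub
    first = trans (cong (λ i → edgeCost (b 0) hub (Y i)) (ahead 0 2 (twice-mono (s≤s z≤n))))
                  (edgeCost-sym (b 0) hub (innerEven 1))
    last : innerCost (suc (twice k)) ≡ edgeCost (b (suc (twice k))) (innerOdd k) hub
    last = cong₂ (edgeCost (b (suc (twice k)))) (interleave-odd innerEven innerOdd k)
      (cong Y (wrap (suc (twice k)) 2 0 (trans (+-comm (suc (twice k)) 2) (cong suc (twice≡2* m)))
                                        (s≤s z≤n)))

  sum-to-n : ∀ f → ∑ℕ n f ≡ ∑ℕ (suc (twice m)) f
  sum-to-n f = cong (λ N → ∑ℕ (suc N) f) (sym (twice≡2* m))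

  outer-total : ∑ℕ n outerCost ≡ ∑ℕ m (λ t → outerCost (twice t) + outerCost (suc (twice t)))
  outer-total = begin
    ∑ℕ n outerCost                                ≡⟨ sum-to-n outerCost ⟩
    ∑ℕ (suc (twice m)) outerCost                  ≡⟨ ∑ℕ-last (twice m) outerCost ⟩
    ∑ℕ (twice m) outerCost + outerCost (twice m)  ≡⟨ cong₂ _+_ (∑ℕ-pairs m outerCost) outer-closing ⟩
    ∑ℕ m (λ t → outerCost (twice t) + outerCost (suc (twice t))) + 0  ≡⟨ +-identityʳ _ ⟩
    ∑ℕ m (λ t → outerCost (twice t) + outerCost (suc (twice t)))      ∎
    where open ≡-Reasoning

  inner-total : ∑ℕ n innerCost ≡ innerCost 0 + innerCost (suc (twice k))
  inner-total = begin
    ∑ℕ n innerCost                                        ≡⟨ sum-to-n innerCost ⟩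
    innerCost 0 + ∑ℕ (suc (suc (twice k))) (innerCost ∘ suc)
      ≡⟨ cong (innerCost 0 +_) (∑ℕ-last (suc (twice k)) (innerCost ∘ suc)) ⟩
    innerCost 0 + (∑ℕ (suc (twice k)) (innerCost ∘ suc) + innerCost (twice m))
      ≡⟨ cong (λ z → innerCost 0 + (z + innerCost (twice m))) (∑ℕ-last (twice k) (innerCost ∘ suc)) ⟩
    innerCost 0 + (∑ℕ (twice k) (innerCost ∘ suc) + innerCost (suc (twice k)) + innerCost (twice m))
      ≡⟨ cong₂ (λ z w → innerCost 0 + (z + innerCost (suc (twice k)) + w)) inner-path inner-closing ⟩
    innerCost 0 + (innerCost (suc (twice k)) + 0)         ≡⟨ cong (innerCost 0 +_) (+-identityʳ _) ⟩
    innerCost 0 + innerCost (suc (twice k))               ∎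
    where
    open ≡-Reasoning
    inner-path : ∑ℕ (twice k) (innerCost ∘ suc) ≡ 0
    inner-path = trans (∑ℕ-pairs k (innerCost ∘ suc))
      (∑ℕ-zero k (λ t t<k → cong₂ _+_ (inner-tree-odd t t<k) (inner-tree-even t t<k)))

  spoke-total : ∑ℕ n spokeCost ≡ spokeCost 0 + ∑ℕ m (λ t → spokeCost (suc (twice t)))
  spoke-total = begin
    ∑ℕ n spokeCost                                        ≡⟨ sum-to-n spokeCost ⟩
    spokeCost 0 + ∑ℕ (twice m) (spokeCost ∘ suc)
      ≡⟨ cong (spokeCost 0 +_) (∑ℕ-pairs m (spokeCost ∘ suc)) ⟩
    spokeCost 0 + ∑ℕ m (λ t → spokeCost (suc (twice t)) + spokeCost (twice (suc t)))
      ≡⟨ cong (spokeCost 0 +_) (∑ℕ-cong m (λ t _ → even-spoke-vanishes t)) ⟩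
    spokeCost 0 + ∑ℕ m (λ t → spokeCost (suc (twice t)))  ∎
    where
    open ≡-Reasoning
    even-spoke-vanishes : ∀ t → spokeCost (suc (twice t)) + spokeCost (twice (suc t)) ≡ spokeCost (suc (twice t))
    even-spoke-vanishes t = trans (cong (spokeCost (suc (twice t)) +_) (spoke-tree t)) (+-identityʳ _)

  switchingCost≤m+1 : switchingCost a b c X Y ≤ m + 1
  switchingCost≤m+1 = begin
    ∑ℕ n outerCost + (∑ℕ n innerCost + ∑ℕ n spokeCost)
      ≡⟨ cong₂ _+_ outer-total (cong₂ _+_ inner-total spoke-total) ⟩
    ∑ℕ m pair + ((innerCost 0 + innerCost (suc (twice k))) + (spokeCost 0 + ∑ℕ m odd))
      ≡⟨ regroup (∑ℕ m pair) (∑ℕ m odd) (innerCost 0) (innerCost (suc (twice k))) (spokeCost 0) ⟩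
    (∑ℕ m pair + ∑ℕ m odd) + hubStar
      ≡⟨ cong (_+ hubStar) (∑ℕ-+ m pair odd) ⟨
    ∑ℕ m (λ t → pair t + odd t) + hubStar            ≤⟨ +-mono-≤ (∑ℕ-mono m star-outer) star-hub ⟩
    ∑ℕ m (λ _ → 1) + 1                                ≡⟨ cong (_+ 1) (∑ℕ-ones m) ⟩
    m + 1                                             ∎
    where
    open ≤-Reasoning
    pair odd : ℕ → ℕ
    pair t = outerCost (twice t) + outerCost (suc (twice t))
    odd  t = spokeCost (suc (twice t))
    hubStar : ℕ
    hubStar = innerCost 0 + innerCost (suc (twice k)) + spokeCost 0
    regroup : ∀ p q x y z → p + ((x + y) + (z + q)) ≡ (p + q) + (x + y + z)
    regroup = solve-∀

oddPetersen-upper : (k : ℕ) → let n = suc (2 * suc k) in (Eneg : Subset (3 * n)) →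
  Σ (Subset (3 * n)) λ S → BalancedAfterDeleting (Petersen n 2) Eneg S × ∣ S ∣ ≤ suc k + 1
oddPetersen-upper k Eneg =
  let S , balanced , ∣S∣≡cost = switching-balances Eneg X Y
  in  S , balanced , subst (_≤ suc k + 1) (sym ∣S∣≡cost) switchingCost≤m+1
  where
  open PetersenEdges (suc (2 * suc k)) 2
  open OddSwitching k (outerSign Eneg) (innerSign Eneg) (spokeSign Eneg)

-- Theorem 3.7: D(P_{2m+1,2}) = m + 1.  (The argument only needs m ≥ 1; the
-- hypothesis m ≥ 2 of the paper ensures 2k < n for k = 2.)

theorem3p7 : (m : ℕ) → 2 ≤ m → IsMaxFrustration (Petersen (suc (2 * m)) 2) (m + 1)
theorem3p7 (suc k) _ =
  maxFrustration-from-bounds (Petersen n 2) (m + 1) ⊤ (oddPetersen-upper k) at-least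
  where
  m n : ℕ
  m = suc k
  n = suc (2 * m)
  2<n : 2 < n
  2<n = s≤s (*-monoʳ-≤ 2 (s≤s z≤n))
  at-least : (S : Subset (3 * n)) → BalancedAfterDeleting (Petersen n 2) ⊤ S → m + 1 ≤ ∣ S ∣
  at-least S balanced =
    subst (_≤ ∣ S ∣) (+-comm 1 m) (*-cancelˡ-< 2 m ∣ S ∣ (Pentagons.lower-bound n 2<n S balanced))
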